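{- Let $s,t,\alpha_1,\ldots,\alpha_s,\beta_1,\ldots,\beta_t$ be positive integers and let $1\le k_1<\cdots<k_s$ and $1\le \ell_1<\cdots<\ell_t$ be integers such that, up to isomorphism of directed graphs, $$\bigotimes_{i=1}^s\left(C_1+\alpha_iC_{k_i}\right)=\bigotimes_{j=1}^t\left(C_1+\beta_jC_{\ell_j}\right).$$ Then $s=t$, and $k_i=\ell_i$ and $\alpha_i=\beta_i$ for all $1\le i\le s$.
   Context: $C_m$ denotes the directed cycle of length $m$ ($C_1$ is a single vertex with a loop). For directed graphs, $G+H$ denotes disjoint union and $mG$ the disjoint union of $m$ copies of $G$. The tensor product $G_1\otimes G_2$ of directed graphs is the directed graph with vertex set $V(G_1)\times V(G_2)$ in which $(v_1,v_2)\to(w_1,w_2)$ is an edge if and only if $v_i\to w_i$ is an edge of $G_i$ for $i=1,2$. -}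

module Defs where

open import Data.Nat using (ℕ; zero; suc)
open import Data.Fin using (Fin; toℕ)
import Data.Fin as F
open import Data.Product using (_×_; _,_)
open import Data.Sum using (_⊎_; inj₁; inj₂)
open import Data.Empty using (⊥)
open import Relation.Binary.PropositionalEquality using (_≡_)
open import Function.Bundles using (_↔_; Inverse)

record Digraph : Set₁ where
  field
    V : Set
    E : V → V → Set
open Digraph public

-- Directed cycle C_m on Fin m : i → i+1, and (m-1) → 0.
-- For m = 1 this is a single vertex with a loop.
C : ℕ → Digraph
C m = record
  { V = Fin m
  ; E = λ i j → (toℕ j ≡ suc (toℕ i)) ⊎ ((suc (toℕ i) ≡ m) × (toℕ j ≡ 0)) }

_⊕_ : Digraph → Digraph → Digraph
G ⊕ H = record { V = V G ⊎ V H ; E = e }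
  where
  e : V G ⊎ V H → V G ⊎ V H → Set
  e (inj₁ u) (inj₁ v) = E G u v
  e (inj₂ u) (inj₂ v) = E H u v
  e _ _ = ⊥

_·_ : ℕ → Digraph → Digraph
m · G = record
  { V = Fin m × V G
  ; E = λ { (a , u) (b , v) → (a ≡ b) × E G u v } }

_⊗_ : Digraph → Digraph → Digraph
G ⊗ H = record
  { V = V G × V H
  ; E = λ { (u₁ , u₂) (v₁ , v₂) → E G u₁ v₁ × E H u₂ v₂ } }

⨂ : (s : ℕ) → (Fin s → Digraph) → Digraph
⨂ zero    G = C 1
⨂ (suc s) G = G F.zero ⊗ ⨂ s (λ i → G (F.suc i))

record _≅_ (G H : Digraph) : Set where
  field
    bij  : V G ↔ V H
    edge : ∀ u v → (E G u v → E H (Inverse.to bij u) (Inverse.to bij v))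
                 × (E H (Inverse.to bij u) (Inverse.to bij v) → E G u v)

{-# OPTIONS --safe #-}
-- Every graph in sight is functional: each vertex has exactly one out-neighbour. An
-- isomorphism of functional digraphs conjugates their successor maps, so it preserves,
-- for every n, the number of vertices fixed by the n-th iterate of the successor map.
-- That number is multiplicative under ⊗ and equals 1 + α·k·[k ∣ n] for C₁ + αC_k, so
-- both sides of the isomorphism give the same function n ↦ ∏ᵢ (1 + αᵢkᵢ[kᵢ ∣ n]).
-- This function is 1 below the least cycle length k₁ and 1 + α₁k₁ at k₁, which
-- recovers (k₁, α₁); cancelling that factor and inducting recovers the rest.
module Submission where

open import Defs
open import Data.Nat using (ℕ; zero; suc; _+_; _*_; _≤_; _<_; z≤n; s≤s; NonZero; >-nonZero)
open import Data.Nat.Properties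
open import Data.Nat.DivMod
open import Data.Nat.Divisibility using (_∣_; _∣?_; divides; ∣-refl; ∣⇒≤; 1∣_)
open import Data.Nat.GeneralisedArithmetic using (fold; +-is-fold)
open import Data.Fin using (Fin; cast; toℕ; fromℕ<)
import Data.Fin as F
import Data.Fin.Properties as FP
open import Data.Fin.Permutation using (↔⇒≡)
open import Data.Vec.Functional using (head; tail)
open import Data.Product using (Σ; _×_; _,_; proj₁; proj₂; map)
import Data.Product.Properties as Product
open import Data.Sum using (_⊎_; inj₁; inj₂)
import Data.Sum as Sum
import Data.Sum.Properties as Sum
open import Data.Empty using (⊥-elim)
open import Function.Base using (id; _∘_)
open import Function.Bundles using (_↔_; Inverse; mk↔ₛ′)
open import Function.Properties.Inverse using (↔-trans; ↔-sym)
open import Data.Product.Function.NonDependent.Propositional using (_×-↔_)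
open import Data.Sum.Function.Propositional using (_⊎-↔_)
open import Axiom.UniquenessOfIdentityProofs using (module Decidable⇒UIP)
open import Relation.Nullary using (yes; no)
open import Relation.Binary using (DecidableEquality; tri<; tri≈; tri>)
open import Relation.Binary.PropositionalEquality

fold-commute : ∀ {A B : Set} {f : A → A} {g : B → B} (h : A → B) →
               (∀ x → h (f x) ≡ g (h x)) → ∀ x n → h (fold x f n) ≡ fold (h x) g n
fold-commute h comm x zero    = refl
fold-commute {g = g} h comm x (suc n) = trans (comm _) (cong g (fold-commute h comm x n))

record Periodic {A : Set} (f : A → A) (n : ℕ) : Set where
  constructor periodic
  field
    point   : A
    returns : fold point f n ≡ point
open Periodic

periodic-≡ : ∀ {A : Set} {f : A → A} {n} → DecidableEquality A →
             {p q : Periodic f n} → point p ≡ point q → p ≡ q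
periodic-≡ _≟_ {periodic x p} {periodic .x q} refl =
  cong (periodic x) (Decidable⇒UIP.≡-irrelevant _≟_ p q)

Periodic-↔ : ∀ {A B : Set} {f : A → A} {g : B → B} →
             DecidableEquality A → DecidableEquality B →
             (h : A ↔ B) → (∀ x → Inverse.to h (f x) ≡ g (Inverse.to h x)) →
             ∀ n → Periodic f n ↔ Periodic g n
Periodic-↔ {f = f} {g} ≟A ≟B h comm n = mk↔ₛ′
  (λ (periodic x p) → periodic (to x) (trans (sym (fold-commute to comm x n)) (cong to p)))
  (λ (periodic y q) → periodic (from y) (trans (sym (fold-commute from comm⁻¹ y n)) (cong from q)))
  (λ _ → periodic-≡ ≟B (strictlyInverseˡ _))
  (λ _ → periodic-≡ ≟A (strictlyInverseʳ _))
  where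
  open Inverse h
  open ≡-Reasoning
  comm⁻¹ : ∀ y → from (g y) ≡ f (from y)
  comm⁻¹ y = begin
    from (g y)             ≡⟨ cong (from ∘ g) (sym (strictlyInverseˡ y)) ⟩
    from (g (to (from y))) ≡⟨ cong from (sym (comm (from y))) ⟩
    from (to (f (from y))) ≡⟨ strictlyInverseʳ _ ⟩
    f (from y)             ∎

Periodic-× : ∀ {A B : Set} {f : A → A} {g : B → B} →
             DecidableEquality A → DecidableEquality B →
             ∀ n → Periodic (map f g) n ↔ (Periodic f n × Periodic g n)
Periodic-× {f = f} {g} ≟A ≟B n = mk↔ₛ′
  (λ (periodic (x , y) p) → periodic x (cong proj₁ (trans (sym (fold-map x y)) p))
                          , periodic y (cong proj₂ (trans (sym (fold-map x y)) p)))
  (λ (periodic x p , periodic y q) → periodic (x , y) (trans (fold-map x y) (cong₂ _,_ p q)))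
  (λ _ → cong₂ _,_ (periodic-≡ ≟A refl) (periodic-≡ ≟B refl))
  (λ _ → periodic-≡ (Product.≡-dec ≟A ≟B) refl)
  where
  fold-map : ∀ x y → fold (x , y) (map f g) n ≡ (fold x f n , fold y g n)
  fold-map x y = cong₂ _,_ (fold-commute proj₁ (λ _ → refl) (x , y) n)
                           (fold-commute proj₂ (λ _ → refl) (x , y) n)

Periodic-⊎ : ∀ {A B : Set} {f : A → A} {g : B → B} →
             DecidableEquality A → DecidableEquality B →
             ∀ n → Periodic (Sum.map f g) n ↔ (Periodic f n ⊎ Periodic g n)
Periodic-⊎ {f = f} {g} ≟A ≟B n = mk↔ₛ′ split merge
  (λ { (inj₁ _) → cong inj₁ (periodic-≡ ≟A refl) ; (inj₂ _) → cong inj₂ (periodic-≡ ≟B refl) })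
  (λ { (periodic (inj₁ _) _) → periodic-≡ (Sum.≡-dec ≟A ≟B) refl
     ; (periodic (inj₂ _) _) → periodic-≡ (Sum.≡-dec ≟A ≟B) refl })
  where
  fold-inj₁ : ∀ x → inj₁ (fold x f n) ≡ fold (inj₁ x) (Sum.map f g) n
  fold-inj₁ x = fold-commute inj₁ (λ _ → refl) x n
  fold-inj₂ : ∀ y → inj₂ (fold y g n) ≡ fold (inj₂ y) (Sum.map f g) n
  fold-inj₂ y = fold-commute inj₂ (λ _ → refl) y n
  split : Periodic (Sum.map f g) n → Periodic f n ⊎ Periodic g n
  split (periodic (inj₁ x) p) = inj₁ (periodic x (Sum.inj₁-injective (trans (fold-inj₁ x) p)))
  split (periodic (inj₂ y) q) = inj₂ (periodic y (Sum.inj₂-injective (trans (fold-inj₂ y) q)))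
  merge : Periodic f n ⊎ Periodic g n → Periodic (Sum.map f g) n
  merge (inj₁ (periodic x p)) = periodic (inj₁ x) (trans (sym (fold-inj₁ x)) (cong inj₁ p))
  merge (inj₂ (periodic y q)) = periodic (inj₂ y) (trans (sym (fold-inj₂ y)) (cong inj₂ q))

fold-id : ∀ {A : Set} (x : A) n → fold x id n ≡ x
fold-id x zero    = refl
fold-id x (suc n) = fold-id x n

Periodic-id : ∀ {A : Set} → DecidableEquality A → ∀ n → Periodic {A} id n ↔ A
Periodic-id ≟A n = mk↔ₛ′ point (λ x → periodic x (fold-id x n)) (λ _ → refl) (λ _ → periodic-≡ ≟A refl)

record Functional (G : Digraph) : Set where
  field
    next      : V G → V G
    next-edge : ∀ u → E G u (next u)
    edge-next : ∀ {u v} → E G u v → next u ≡ v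
    vertex-≟  : DecidableEquality (V G)
open Functional

≅⇒Periodic-↔ : ∀ {G H} → G ≅ H → (FG : Functional G) (FH : Functional H) →
               ∀ n → Periodic (next FG) n ↔ Periodic (next FH) n
≅⇒Periodic-↔ iso FG FH = Periodic-↔ (vertex-≟ FG) (vertex-≟ FH) bij
  (λ u → sym (edge-next FH (proj₁ (edge u (next FG u)) (next-edge FG u))))
  where open _≅_ iso

_⊗ᶠ_ : ∀ {G H} → Functional G → Functional H → Functional (G ⊗ H)
FG ⊗ᶠ FH = record
  { next      = map (next FG) (next FH)
  ; next-edge = λ (u , v) → next-edge FG u , next-edge FH v
  ; edge-next = λ (e , e′) → cong₂ _,_ (edge-next FG e) (edge-next FH e′)
  ; vertex-≟  = Product.≡-dec (vertex-≟ FG) (vertex-≟ FH)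
  }

_⊕ᶠ_ : ∀ {G H} → Functional G → Functional H → Functional (G ⊕ H)
_⊕ᶠ_ {G} {H} FG FH = record
  { next      = Sum.map (next FG) (next FH)
  ; next-edge = λ { (inj₁ u) → next-edge FG u ; (inj₂ v) → next-edge FH v }
  ; edge-next = λ {u} {v} → sum-edge-next {u} {v}
  ; vertex-≟  = Sum.≡-dec (vertex-≟ FG) (vertex-≟ FH)
  }
  where
  sum-edge-next : ∀ {u v} → E (G ⊕ H) u v → Sum.map (next FG) (next FH) u ≡ v
  sum-edge-next {inj₁ _} {inj₁ _} e = cong inj₁ (edge-next FG e)
  sum-edge-next {inj₂ _} {inj₂ _} e = cong inj₂ (edge-next FH e)

_·ᶠ_ : ∀ m {G} → Functional G → Functional (m · G)
m ·ᶠ FG = record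
  { next      = map id (next FG)
  ; next-edge = λ (_ , u) → refl , next-edge FG u
  ; edge-next = λ (a≡b , e) → cong₂ _,_ a≡b (edge-next FG e)
  ; vertex-≟  = Product.≡-dec FP._≟_ (vertex-≟ FG)
  }

rotate : ∀ {m} → Fin (suc m) → Fin (suc m)
rotate {m} i = fromℕ< (m%n<n (suc (toℕ i)) (suc m))

toℕ-rotate : ∀ {m} (i : Fin (suc m)) → toℕ (rotate i) ≡ suc (toℕ i) % suc m
toℕ-rotate {m} i = FP.toℕ-fromℕ< (m%n<n (suc (toℕ i)) (suc m))

cycleᶠ : ∀ k → Functional (C k)
cycleᶠ zero = record
  { next = λ () ; next-edge = λ () ; edge-next = λ { {()} } ; vertex-≟ = FP._≟_ }
cycleᶠ (suc m) = record
  { next = rotate ; next-edge = rotate-edge ; edge-next = edge-rotate ; vertex-≟ = FP._≟_ }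
  where
  rotate-edge : ∀ u → E (C (suc m)) u (rotate u)
  rotate-edge u with m≤n⇒m<n∨m≡n (FP.toℕ<n u)
  ... | inj₁ u+1<k = inj₁ (trans (toℕ-rotate u) (m<n⇒m%n≡m u+1<k))
  ... | inj₂ u+1≡k = inj₂ (u+1≡k , trans (toℕ-rotate u)
                                     (trans (cong (_% suc m) u+1≡k) (n%n≡0 (suc m))))
  edge-rotate : ∀ {u v} → E (C (suc m)) u v → rotate u ≡ v
  edge-rotate {u} {v} (inj₁ v≡u+1) = FP.toℕ-injective (trans (toℕ-rotate u)
    (trans (m<n⇒m%n≡m (subst (_< suc m) v≡u+1 (FP.toℕ<n v))) (sym v≡u+1)))
  edge-rotate {u} {v} (inj₂ (u+1≡k , v≡0)) = FP.toℕ-injective (trans (toℕ-rotate u)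
    (trans (cong (_% suc m) u+1≡k) (trans (n%n≡0 (suc m)) (sym v≡0))))

⨂ᶠ : ∀ s {G : Fin s → Digraph} → (∀ i → Functional (G i)) → Functional (⨂ s G)
⨂ᶠ zero    F = cycleᶠ 1
⨂ᶠ (suc s) F = F F.zero ⊗ᶠ ⨂ᶠ s (F ∘ F.suc)

suc-% : ∀ x d .{{_ : NonZero d}} → suc (x % d) % d ≡ suc x % d
suc-% x d = begin
  (1 + x % d) % d               ≡⟨ %-distribˡ-+ 1 (x % d) d ⟩
  (1 % d + x % d % d) % d       ≡⟨ cong (λ r → (1 % d + r) % d) (m%n%n≡m%n x d) ⟩
  (1 % d + x % d) % d           ≡⟨ %-distribˡ-+ 1 x d ⟨
  (1 + x) % d                   ∎
  where open ≡-Reasoning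

toℕ-fold-rotate : ∀ {m} (i : Fin (suc m)) n → toℕ (fold i rotate n) ≡ (n + toℕ i) % suc m
toℕ-fold-rotate {m} i n = begin
  toℕ (fold i rotate n)               ≡⟨ fold-commute toℕ toℕ-rotate i n ⟩
  fold (toℕ i) step n                 ≡⟨ cong (λ x → fold x step n) (m<n⇒m%n≡m (FP.toℕ<n i)) ⟨
  fold (toℕ i % suc m) step n         ≡⟨ fold-commute (_% suc m) (λ x → sym (suc-% x (suc m))) (toℕ i) n ⟨
  fold (toℕ i) suc n % suc m          ≡⟨ cong (_% suc m) (+-is-fold n) ⟩
  (n + toℕ i) % suc m                 ∎
  where
  open ≡-Reasoning
  step : ℕ → ℕ
  step x = suc x % suc m

fold-rotate-≡⇒∣ : ∀ {m} (i : Fin (suc m)) n → fold i rotate n ≡ i → suc m ∣ n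
fold-rotate-≡⇒∣ {m} i n fixed = divides ((n + toℕ i) / suc m) (+-cancelʳ-≡ (toℕ i) _ _ (begin
  n + toℕ i                                          ≡⟨ m≡m%n+[m/n]*n (n + toℕ i) (suc m) ⟩
  (n + toℕ i) % suc m + (n + toℕ i) / suc m * suc m  ≡⟨ cong (_+ (n + toℕ i) / suc m * suc m) remainder ⟩
  toℕ i + (n + toℕ i) / suc m * suc m                ≡⟨ +-comm (toℕ i) _ ⟩
  (n + toℕ i) / suc m * suc m + toℕ i                ∎))
  where
  open ≡-Reasoning
  remainder : (n + toℕ i) % suc m ≡ toℕ i
  remainder = trans (sym (toℕ-fold-rotate i n)) (cong toℕ fixed)

∣⇒fold-rotate-≡ : ∀ {m} (i : Fin (suc m)) n → suc m ∣ n → fold i rotate n ≡ i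
∣⇒fold-rotate-≡ i n k∣n = FP.toℕ-injective (trans (toℕ-fold-rotate i n)
  (trans (%-remove-+ˡ (toℕ i) k∣n) (m<n⇒m%n≡m (FP.toℕ<n i))))

cyclePoints : ℕ → ℕ → ℕ
cyclePoints k n with k ∣? n
... | yes _ = k
... | no  _ = 0

Periodic-C : ∀ k n → Periodic (next (cycleᶠ k)) n ↔ Fin (cyclePoints k n)
Periodic-C zero n with 0 ∣? n
... | yes _ = mk↔ₛ′ (λ { (periodic () _) }) (λ ()) (λ ()) (λ { (periodic () _) })
... | no  _ = mk↔ₛ′ (λ { (periodic () _) }) (λ ()) (λ ()) (λ { (periodic () _) })
Periodic-C (suc m) n with suc m ∣? n
... | yes k∣n = mk↔ₛ′ point (λ i → periodic i (∣⇒fold-rotate-≡ i n k∣n)) (λ _ → refl)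
                       (λ _ → periodic-≡ FP._≟_ refl)
... | no  k∤n = mk↔ₛ′ (λ (periodic i p) → ⊥-elim (k∤n (fold-rotate-≡⇒∣ i n p))) (λ ())
                       (λ ()) (λ (periodic i p) → ⊥-elim (k∤n (fold-rotate-≡⇒∣ i n p)))

cyclePoints-1 : ∀ n → cyclePoints 1 n ≡ 1
cyclePoints-1 n with 1 ∣? n
... | yes _  = refl
... | no 1∤n = ⊥-elim (1∤n (1∣ n))

cyclePoints-self : ∀ k → cyclePoints k k ≡ k
cyclePoints-self k with k ∣? k
... | yes _  = refl
... | no k∤k = ⊥-elim (k∤k ∣-refl)

cyclePoints-< : ∀ {k n} → 1 ≤ n → n < k → cyclePoints k n ≡ 0
cyclePoints-< {k} {n@(suc _)} _ n<k with k ∣? n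
... | yes k∣n = ⊥-elim (<⇒≱ n<k (∣⇒≤ k∣n))
... | no  _   = refl

Periodic-C₁ : ∀ n → Periodic (next (cycleᶠ 1)) n ↔ Fin 1
Periodic-C₁ n = subst (λ c → Periodic (next (cycleᶠ 1)) n ↔ Fin c) (cyclePoints-1 n) (Periodic-C 1 n)

∏ : ∀ s → (Fin s → ℕ) → ℕ
∏ zero    a = 1
∏ (suc s) a = head a * ∏ s (tail a)

Periodic-⨂ : ∀ s {G : Fin s → Digraph} (F : ∀ i → Functional (G i)) (a : Fin s → ℕ) n →
             (∀ i → Periodic (next (F i)) n ↔ Fin (a i)) →
             Periodic (next (⨂ᶠ s F)) n ↔ Fin (∏ s a)
Periodic-⨂ zero    F a n _      = Periodic-C₁ n
Periodic-⨂ (suc s) F a n counts =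
  ↔-trans (Periodic-× (vertex-≟ (F F.zero)) (vertex-≟ (⨂ᶠ s (F ∘ F.suc))) n)
  (↔-trans (counts F.zero ×-↔ Periodic-⨂ s (F ∘ F.suc) (tail a) n (counts ∘ F.suc))
           (↔-sym FP.*↔×))

factor : ℕ → ℕ → Digraph
factor α k = C 1 ⊕ (α · C k)

factorᶠ : ∀ α k → Functional (factor α k)
factorᶠ α k = cycleᶠ 1 ⊕ᶠ (α ·ᶠ cycleᶠ k)

Periodic-factor : ∀ α k n → Periodic (next (factorᶠ α k)) n ↔ Fin (1 + α * cyclePoints k n)
Periodic-factor α k n =
  ↔-trans (Periodic-⊎ FP._≟_ (vertex-≟ (α ·ᶠ cycleᶠ k)) n)
  (↔-trans (Periodic-C₁ n ⊎-↔ copies) (↔-sym FP.+↔⊎))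
  where
  copies : Periodic (map id (next (cycleᶠ k))) n ↔ Fin (α * cyclePoints k n)
  copies = ↔-trans (Periodic-× FP._≟_ FP._≟_ n)
           (↔-trans (Periodic-id FP._≟_ n ×-↔ Periodic-C k n) (↔-sym FP.*↔×))

periodicCount : ∀ s → (α k : Fin s → ℕ) → ℕ → ℕ
periodicCount s α k n = ∏ s (λ i → 1 + α i * cyclePoints (k i) n)

≅⇒periodicCount-≡ : ∀ s t (α k : Fin s → ℕ) (β ℓ : Fin t → ℕ) →
  ⨂ s (λ i → factor (α i) (k i)) ≅ ⨂ t (λ j → factor (β j) (ℓ j)) →
  ∀ n → periodicCount s α k n ≡ periodicCount t β ℓ n
≅⇒periodicCount-≡ s t α k β ℓ iso n = ↔⇒≡ (↔-trans (↔-sym (count s α k))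
  (↔-trans (≅⇒Periodic-↔ iso (⨂ᶠ s (λ i → factorᶠ (α i) (k i)))
                             (⨂ᶠ t (λ j → factorᶠ (β j) (ℓ j))) n)
           (count t β ℓ)))
  where
  count : ∀ r (γ m : Fin r → ℕ) →
          Periodic (next (⨂ᶠ r (λ i → factorᶠ (γ i) (m i)))) n ↔ Fin (periodicCount r γ m n)
  count r γ m = Periodic-⨂ r _ _ n (λ i → Periodic-factor (γ i) (m i) n)

StrictlyIncreasing : ∀ {s} → (Fin s → ℕ) → Set
StrictlyIncreasing k = ∀ i i′ → i F.< i′ → k i < k i′

StrictlyIncreasing-tail : ∀ {s} {k : Fin (suc s) → ℕ} →
                          StrictlyIncreasing k → StrictlyIncreasing (tail k)
StrictlyIncreasing-tail k↑ i i′ i<i′ = k↑ (F.suc i) (F.suc i′) (s≤s i<i′)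

head-least : ∀ {s} {k : Fin (suc s) → ℕ} → StrictlyIncreasing k → ∀ i → head k ≤ k i
head-least k↑ F.zero    = ≤-refl
head-least k↑ (F.suc i) = <⇒≤ (k↑ F.zero (F.suc i) (s≤s z≤n))

periodicCount-below : ∀ s (α k : Fin s → ℕ) m → 1 ≤ m → (∀ i → m < k i) →
                      periodicCount s α k m ≡ 1
periodicCount-below zero    α k m _   _   = refl
periodicCount-below (suc s) α k m m≥1 m<k
  rewrite cyclePoints-< m≥1 (m<k F.zero) | *-zeroʳ (head α)
  = trans (*-identityˡ _) (periodicCount-below s (tail α) (tail k) m m≥1 (m<k ∘ F.suc))

periodicCount-head : ∀ s (α k : Fin (suc s) → ℕ) → 1 ≤ head k → StrictlyIncreasing k →
                     periodicCount (suc s) α k (head k) ≡ 1 + head α * head k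
periodicCount-head s α k k≥1 k↑
  rewrite periodicCount-below s (tail α) (tail k) (head k) k≥1
            (λ i → k↑ F.zero (F.suc i) (s≤s z≤n))
        | cyclePoints-self (head k)
  = *-identityʳ _

1+*≢1 : ∀ {a b} → 1 ≤ a → 1 ≤ b → 1 + a * b ≢ 1
1+*≢1 {suc _} {suc _} _ _ ()

least-length-unmatched : ∀ s t (α k : Fin (suc s) → ℕ) (β ℓ : Fin t → ℕ) →
  1 ≤ head α → 1 ≤ head k → StrictlyIncreasing k → (∀ j → head k < ℓ j) →
  periodicCount (suc s) α k (head k) ≢ periodicCount t β ℓ (head k)
least-length-unmatched s t α k β ℓ α≥1 k≥1 k↑ k<ℓ eq = 1+*≢1 α≥1 k≥1 (begin
  1 + head α * head k                ≡⟨ periodicCount-head s α k k≥1 k↑ ⟨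
  periodicCount (suc s) α k (head k) ≡⟨ eq ⟩
  periodicCount t β ℓ (head k)       ≡⟨ periodicCount-below t β ℓ (head k) k≥1 k<ℓ ⟩
  1                                  ∎)
  where open ≡-Reasoning

head-multiplicity-≡ : ∀ s t (α k : Fin (suc s) → ℕ) (β ℓ : Fin (suc t) → ℕ) →
  1 ≤ head k → StrictlyIncreasing k → StrictlyIncreasing ℓ → head k ≡ head ℓ →
  periodicCount (suc s) α k (head k) ≡ periodicCount (suc t) β ℓ (head k) →
  head α ≡ head β
head-multiplicity-≡ s t α k β ℓ k≥1 k↑ ℓ↑ k≡ℓ eq =
  *-cancelʳ-≡ (head α) (head β) (head k) {{>-nonZero k≥1}} (suc-injective (begin
    1 + head α * head k                  ≡⟨ periodicCount-head s α k k≥1 k↑ ⟨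
    periodicCount (suc s) α k (head k)   ≡⟨ eq ⟩
    periodicCount (suc t) β ℓ (head k)   ≡⟨ cong (periodicCount (suc t) β ℓ) k≡ℓ ⟩
    periodicCount (suc t) β ℓ (head ℓ)   ≡⟨ periodicCount-head t β ℓ (subst (1 ≤_) k≡ℓ k≥1) ℓ↑ ⟩
    1 + head β * head ℓ                  ≡⟨ cong (λ x → 1 + head β * x) k≡ℓ ⟨
    1 + head β * head k                  ∎))
  where open ≡-Reasoning

periodicCount-tail-≡ : ∀ s t (α k : Fin (suc s) → ℕ) (β ℓ : Fin (suc t) → ℕ) →
  head α ≡ head β → head k ≡ head ℓ →
  (∀ n → periodicCount (suc s) α k n ≡ periodicCount (suc t) β ℓ n) →
  ∀ n → periodicCount s (tail α) (tail k) n ≡ periodicCount t (tail β) (tail ℓ) n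
periodicCount-tail-≡ s t α k β ℓ α≡β k≡ℓ eq n =
  *-cancelˡ-≡ _ _ (1 + head α * cyclePoints (head k) n)
    (trans (eq n) (cong (_* periodicCount t (tail β) (tail ℓ) n) (sym same-head-factor)))
  where
  same-head-factor : 1 + head α * cyclePoints (head k) n ≡ 1 + head β * cyclePoints (head ℓ) n
  same-head-factor = cong₂ (λ a c → 1 + a * cyclePoints c n) α≡β k≡ℓ

periodicCount-injective : ∀ s t (α k : Fin s → ℕ) (β ℓ : Fin t → ℕ) →
  (∀ i → 1 ≤ α i) → (∀ j → 1 ≤ β j) →
  (∀ i → 1 ≤ k i) → StrictlyIncreasing k → (∀ j → 1 ≤ ℓ j) → StrictlyIncreasing ℓ →
  (∀ n → periodicCount s α k n ≡ periodicCount t β ℓ n) →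
  Σ (s ≡ t) (λ p → ∀ i → (k i ≡ ℓ (cast p i)) × (α i ≡ β (cast p i)))
periodicCount-injective zero zero _ _ _ _ _ _ _ _ _ _ _ = refl , λ ()
periodicCount-injective zero (suc t) α k β ℓ _ β≥1 _ _ ℓ≥1 ℓ↑ eq =
  ⊥-elim (least-length-unmatched t zero β ℓ α k (β≥1 F.zero) (ℓ≥1 F.zero) ℓ↑ (λ ()) (sym (eq _)))
periodicCount-injective (suc s) zero α k β ℓ α≥1 _ k≥1 k↑ _ _ eq =
  ⊥-elim (least-length-unmatched s zero α k β ℓ (α≥1 F.zero) (k≥1 F.zero) k↑ (λ ()) (eq _))
periodicCount-injective (suc s) (suc t) α k β ℓ α≥1 β≥1 k≥1 k↑ ℓ≥1 ℓ↑ eq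
  with <-cmp (head k) (head ℓ)
... | tri< k<ℓ _ _ = ⊥-elim (least-length-unmatched s (suc t) α k β ℓ (α≥1 F.zero) (k≥1 F.zero) k↑
                       (λ j → <-≤-trans k<ℓ (head-least ℓ↑ j)) (eq _))
... | tri> _ _ ℓ<k = ⊥-elim (least-length-unmatched t (suc s) β ℓ α k (β≥1 F.zero) (ℓ≥1 F.zero) ℓ↑
                       (λ i → <-≤-trans ℓ<k (head-least k↑ i)) (sym (eq _)))
... | tri≈ _ k≡ℓ _ = cong suc s≡t , λ { F.zero → k≡ℓ , α≡β ; (F.suc i) → tails-≡ i }
  where
  α≡β : head α ≡ head β
  α≡β = head-multiplicity-≡ s t α k β ℓ (k≥1 F.zero) k↑ ℓ↑ k≡ℓ (eq _)
  tails = periodicCount-injective s t (tail α) (tail k) (tail β) (tail ℓ)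
            (α≥1 ∘ F.suc) (β≥1 ∘ F.suc) (k≥1 ∘ F.suc) (StrictlyIncreasing-tail k↑)
            (ℓ≥1 ∘ F.suc) (StrictlyIncreasing-tail ℓ↑)
            (periodicCount-tail-≡ s t α k β ℓ α≡β k≡ℓ eq)
  s≡t = proj₁ tails
  tails-≡ = proj₂ tails

theorem3 : (s t : ℕ) → 1 ≤ s → 1 ≤ t →
    (α k : Fin s → ℕ) → (β ℓ : Fin t → ℕ) →
    (∀ i → 1 ≤ α i) → (∀ j → 1 ≤ β j) →
    (∀ i → 1 ≤ k i) → (∀ i i′ → i F.< i′ → k i < k i′) →
    (∀ j → 1 ≤ ℓ j) → (∀ j j′ → j F.< j′ → ℓ j < ℓ j′) →
    ⨂ s (λ i → C 1 ⊕ (α i · C (k i))) ≅ ⨂ t (λ j → C 1 ⊕ (β j · C (ℓ j))) →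
    Σ (s ≡ t) (λ p → ∀ i → (k i ≡ ℓ (cast p i)) × (α i ≡ β (cast p i)))
theorem3 s t _ _ α k β ℓ α≥1 β≥1 k≥1 k↑ ℓ≥1 ℓ↑ iso =
  periodicCount-injective s t α k β ℓ α≥1 β≥1 k≥1 k↑ ℓ≥1 ℓ↑
    (≅⇒periodicCount-≡ s t α k β ℓ iso)
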